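{- For every integer $n\ge 4$, the star topology on the Whitney complex of the cycle graph $C_n$ has exactly $L(2n)$ open sets, where $L$ denotes the Lucas numbers, $L(0)=2$, $L(1)=1$, $L(k+1)=L(k)+L(k-1)$.
   Context: The cycle graph $C_n$ has vertices $1,\dots,n$ and edges $\{i,i+1\}$ (indices mod $n$); for $n\ge4$ its Whitney complex (set of vertex sets of complete subgraphs) consists of the $n$ singletons $\{i\}$ and the $n$ edges $\{i,i+1\}$. For a finite abstract simplicial complex $\mathcal{G}$ and $x\in\mathcal{G}$, the star is $U(x)=\{y\in\mathcal{G}: x\subseteq y\}$; the stars together with $\emptyset$ form a basis of the star topology on $\mathcal{G}$. -}

module Defs where

open import Data.Nat using (ℕ; zero; suc; _+_)
open import Data.Bool using (Bool; true; false; _∧_; _∨_)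
import Data.Bool.Properties as BoolP
open import Data.Fin using (Fin; toℕ)
open import Data.Fin.Subset using (Subset; ⁅_⁆; _∪_)
open import Data.Fin.Subset.Properties using (_⊆?_)
open import Data.Sum using (_⊎_; inj₁; inj₂)
open import Data.Product using (_×_; _,_)
import Data.Product.Properties as ProdP
open import Data.Vec using (Vec; []; _∷_; lookup; tabulate)
import Data.Vec.Properties as VecP
open import Data.List using (List; []; _∷_; map; concatMap; deduplicate; length)
open import Relation.Nullary using (does)
open import Relation.Binary.Definitions using (DecidableEquality)
open import Data.Nat.DivMod using (_mod_)

lucas : ℕ → ℕ
lucas zero = 2
lucas (suc zero) = 1
lucas (suc (suc k)) = lucas (suc k) + lucas k

next : ∀ {n} → Fin n → Fin n
next {suc m} i = suc (toℕ i) mod suc m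

-- Whitney complex of C_n (n ≥ 4): inj₁ i is the singleton {i},
-- inj₂ i is the edge {i , i+1 mod n}.
Simplex : ℕ → Set
Simplex n = Fin n ⊎ Fin n

verts : ∀ {n} → Simplex n → Subset n
verts (inj₁ i) = ⁅ i ⁆
verts (inj₂ i) = ⁅ i ⁆ ∪ ⁅ next i ⁆

_≼ᵇ_ : ∀ {n} → Simplex n → Simplex n → Bool
x ≼ᵇ y = does (verts x ⊆? verts y)

-- a subset of the complex: (which singletons , which edges)
SubG : ℕ → Set
SubG n = Subset n × Subset n

_∈ᵇ_ : ∀ {n} → Simplex n → SubG n → Bool
inj₁ i ∈ᵇ (A , B) = lookup A i
inj₂ i ∈ᵇ (A , B) = lookup B i

anyFin : ∀ {n} → (Fin n → Bool) → Bool
anyFin {zero} f = false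
anyFin {suc n} f = f Fin.zero ∨ anyFin (λ i → f (Fin.suc i))

anySimplex : ∀ {n} → (Simplex n → Bool) → Bool
anySimplex f = anyFin (λ i → f (inj₁ i)) ∨ anyFin (λ i → f (inj₂ i))

star : ∀ {n} → Simplex n → SubG n
star x = tabulate (λ j → x ≼ᵇ inj₁ j) , tabulate (λ j → x ≼ᵇ inj₂ j)

unionOfStars : ∀ {n} → SubG n → SubG n
unionOfStars F =
  tabulate (λ j → anySimplex (λ x → (x ∈ᵇ F) ∧ (x ≼ᵇ inj₁ j))) ,
  tabulate (λ j → anySimplex (λ x → (x ∈ᵇ F) ∧ (x ≼ᵇ inj₂ j)))

allSubsets : ∀ n → List (Subset n)
allSubsets zero = [] ∷ []
allSubsets (suc n) = concatMap (λ s → (false ∷ s) ∷ (true ∷ s) ∷ []) (allSubsets n)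

allSubG : ∀ n → List (SubG n)
allSubG n = concatMap (λ A → map (λ B → A , B) (allSubsets n)) (allSubsets n)

_≟G_ : ∀ {n} → DecidableEquality (SubG n)
_≟G_ = ProdP.≡-dec (VecP.≡-dec BoolP._≟_) (VecP.≡-dec BoolP._≟_)

-- open sets of the star topology: the unions of basis elements
-- (stars and ∅), listed without repetition
openSets : ∀ n → List (SubG n)
openSets n = deduplicate _≟G_ (map unionOfStars (allSubG n))

module Submission where

-- The union of the stars of the simplices in F = (A , B) is (A , E A ∪ B), where E A is the set
-- of edges meeting A.  So the open sets are the pairs with E A ⊆ B, and a vertex set A is the first
-- component of exactly 2 ^ (number of edges missing A) of them.  Cutting the cycle at a vertex turns
-- the sum of these weights into a walk along a path with transfer matrix [[2,1],[1,1]], the square of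
-- the Fibonacci matrix; its trace after n steps is F(2n+1) + F(2n-1) = L(2n).

open import Defs
open import Data.Nat using (ℕ; _≤_; _*_)
open import Data.List using (length)
open import Relation.Binary.PropositionalEquality using (_≡_)

open import Algebra.Bundles using (CommutativeMonoid)
import Algebra.Properties.CommutativeSemigroup as CommutativeSemigroupProperties
open import Data.Bool using (Bool; true; false; _∧_; _∨_)
open import Data.Bool.Properties using (∧-zeroʳ; ∧-identityʳ; ∨-identityʳ; ∧-distribˡ-∨; ∨-commutativeMonoid)
open import Data.Empty using (⊥-elim)
open import Data.Fin using (Fin; zero; suc; toℕ; fromℕ; inject₁; _≟_)
open import Data.Fin.Properties
  using (toℕ-injective; toℕ-fromℕ; toℕ-fromℕ<; toℕ-inject₁; toℕ<n; 0≢1+n; suc-injective)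
open import Data.Fin.Relation.Unary.Top using (view; ‵fromℕ; ‵inject₁)
open import Data.Fin.Subset using (Subset; outside; inside; _∈_; _⊆_; _∪_; ⁅_⁆; ∁; ∣_∣)
open import Data.Fin.Subset.Properties
  using (_⊆?_; ⊆-antisym; x∈⁅x⁆; x∈⁅y⁆⇒x≡y; x∈⁅y⁆⇔x≡y; p⊆p∪q; q⊆p∪q; x∈p∪q⁻; x∈p∪q⁺)
open import Data.List
  using (List; []; _∷_; _++_; map; concatMap; filter; deduplicate; cartesianProductWith; cartesianProduct)
open import Data.List.Properties using (filter-++; length-++; map-cong)
open import Data.List.Membership.Propositional using () renaming (_∈_ to _∈ˡ_)
open import Data.List.Membership.Propositional.Properties
  using (∈-map⁺; ∈-map⁻; ∈-filter⁺; ∈-filter⁻; deduplicate-∈⇔; ∈-cartesianProductWith⁺; ∈-cartesianProduct⁺)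
open import Data.List.Membership.Propositional.Properties.WithK using (unique∧set⇒bag)
open import Data.List.Relation.Binary.BagAndSetEquality using (∼bag⇒↭)
open import Data.List.Relation.Binary.Permutation.Propositional.Properties using (↭-length)
open import Data.List.Relation.Unary.All using ([]; _∷_)
open import Data.List.Relation.Unary.AllPairs using ([]; _∷_)
open import Data.List.Relation.Unary.Any using (here; there)
open import Data.List.Relation.Unary.Unique.Propositional using (Unique)
open import Data.List.Relation.Unary.Unique.Propositional.Properties
  using (filter⁺; cartesianProductWith⁺; cartesianProduct⁺)
open import Data.List.Relation.Unary.Unique.DecPropositional.Properties using (deduplicate-!)
open import Data.Nat using (zero; suc; _+_; _^_; _%_; s≤s)
open import Data.Nat.DivMod using (n%n≡0; m<n⇒m%n≡m)
open import Data.Nat.ListAction using (sum)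
import Data.Nat.Properties as ℕ
open import Data.Nat.Tactic.RingSolver using (solve-∀)
open import Data.Product using (_×_; _,_; proj₁; proj₂; swap)
open import Data.Product.Function.NonDependent.Propositional using (_×-⇔_)
open import Data.Sum using (_⊎_; inj₁; inj₂; [_,_])
open import Data.Vec using (Vec; []; _∷_; _∷ʳ_; lookup; tabulate)
open import Data.Vec.Properties using (∷-injective; lookup-zipWith; tabulate-cong; tabulate∘lookup)
open import Function using (_∘_; _$_; id)
open import Function.Bundles using (_⇔_; mk⇔; Equivalence)
open import Function.Properties.Equivalence using () renaming (trans to ⇔-trans; sym to ⇔-sym)
open import Relation.Binary.Definitions using (DecidableEquality)
open import Relation.Binary.PropositionalEquality
  using (refl; sym; trans; cong; cong₂; subst; _≢_; module ≡-Reasoning)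
open import Relation.Nullary using (does)
open import Relation.Nullary.Decidable using (does-⇔; dec-false; _⊎-dec_)
open import Relation.Unary using (Decidable)

open CommutativeSemigroupProperties ℕ.+-commutativeSemigroup using () renaming (interchange to +-interchange)
open CommutativeSemigroupProperties (CommutativeMonoid.commutativeSemigroup ∨-commutativeMonoid)
  using () renaming (interchange to ∨-interchange)
open Equivalence using (to; from)
open ≡-Reasoning

-- Cycle arithmetic

next-fromℕ : ∀ m → next (fromℕ m) ≡ zero
next-fromℕ m = toℕ-injective $ begin
  toℕ (next (fromℕ m))          ≡⟨ toℕ-fromℕ< _ ⟩
  suc (toℕ (fromℕ m)) % suc m   ≡⟨ cong (λ t → suc t % suc m) (toℕ-fromℕ m) ⟩
  suc m % suc m                 ≡⟨ n%n≡0 (suc m) ⟩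
  0                             ∎

next-inject₁ : ∀ {m} (j : Fin m) → next (inject₁ j) ≡ suc j
next-inject₁ {m} j = toℕ-injective $ begin
  toℕ (next (inject₁ j))          ≡⟨ toℕ-fromℕ< _ ⟩
  suc (toℕ (inject₁ j)) % suc m   ≡⟨ cong (λ t → suc t % suc m) (toℕ-inject₁ j) ⟩
  suc (toℕ j) % suc m             ≡⟨ m<n⇒m%n≡m (s≤s (toℕ<n j)) ⟩
  suc (toℕ j)                     ∎

next-irreflexive : ∀ {k} (i : Fin (2 + k)) → next i ≢ i
next-irreflexive i with view i
... | ‵fromℕ      = 0≢1+n ∘ trans (sym (next-fromℕ _))
... | ‵inject₁ j = λ eq → ℕ.1+n≢n $ begin
  suc (toℕ j)             ≡⟨ cong toℕ (sym (next-inject₁ j)) ⟩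
  toℕ (next (inject₁ j))  ≡⟨ cong toℕ eq ⟩
  toℕ (inject₁ j)         ≡⟨ toℕ-inject₁ j ⟩
  toℕ j                   ∎

next²-irreflexive : ∀ {k} (i : Fin (3 + k)) → next (next i) ≢ i
next²-irreflexive {k} i with view i
... | ‵fromℕ = λ eq → 0≢1+n $ suc-injective $ begin
  suc zero                     ≡⟨ sym (next-inject₁ zero) ⟩
  next zero                    ≡⟨ cong next (sym (next-fromℕ (2 + k))) ⟩
  next (next (fromℕ (2 + k)))  ≡⟨ eq ⟩
  fromℕ (2 + k)                ∎
... | ‵inject₁ j rewrite next-inject₁ j with view j
...   | ‵fromℕ = 0≢1+n ∘ trans (sym (next-fromℕ _))
...   | ‵inject₁ l = λ eq → ℕ.m+1+n≢n 1 $ begin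
  2 + toℕ l                           ≡⟨ cong toℕ (sym (next-inject₁ (suc l))) ⟩
  toℕ (next (inject₁ (suc l)))        ≡⟨ cong toℕ eq ⟩
  toℕ (inject₁ (inject₁ l))           ≡⟨ trans (toℕ-inject₁ (inject₁ l)) (toℕ-inject₁ l) ⟩
  toℕ l                               ∎

-- Unions of stars

module _ {n : ℕ} where

  ⁅x⁆⊆p⇔x∈p : ∀ {x : Fin n} {p} → ⁅ x ⁆ ⊆ p ⇔ x ∈ p
  ⁅x⁆⊆p⇔x∈p {x} {p} = mk⇔ (λ x⊆p → x⊆p (x∈⁅x⁆ x))
                          (λ x∈p {y} y∈⁅x⁆ → subst (_∈ p) (sym (x∈⁅y⁆⇒x≡y x y∈⁅x⁆)) x∈p)

  p∪q⊆r⇔p⊆r×q⊆r : ∀ {p q r : Subset n} → p ∪ q ⊆ r ⇔ (p ⊆ r × q ⊆ r)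
  p∪q⊆r⇔p⊆r×q⊆r {p} {q} {r} = mk⇔
    (λ p∪q⊆r → (λ {x} x∈p → p∪q⊆r (p⊆p∪q q x∈p)) , (λ {x} x∈q → p∪q⊆r (q⊆p∪q p q x∈q)))
    (λ (p⊆r , q⊆r) {x} x∈p∪q → [ (λ x∈p → p⊆r x∈p) , (λ x∈q → q⊆r x∈q) ] (x∈p∪q⁻ p q x∈p∪q))

  edge⊆p⇔ : ∀ {i : Fin n} {p} → verts (inj₂ i) ⊆ p ⇔ (i ∈ p × next i ∈ p)
  edge⊆p⇔ = ⇔-trans p∪q⊆r⇔p⊆r×q⊆r (⁅x⁆⊆p⇔x∈p ×-⇔ ⁅x⁆⊆p⇔x∈p)

  x∈⁅y⁆∪⁅z⁆⇔ : ∀ {x y z : Fin n} → x ∈ ⁅ y ⁆ ∪ ⁅ z ⁆ ⇔ (x ≡ y ⊎ x ≡ z)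
  x∈⁅y⁆∪⁅z⁆⇔ {x} {y} {z} = mk⇔
    ([ inj₁ ∘ x∈⁅y⁆⇒x≡y y , inj₂ ∘ x∈⁅y⁆⇒x≡y z ] ∘ x∈p∪q⁻ ⁅ y ⁆ ⁅ z ⁆)
    (λ { (inj₁ refl) → x∈p∪q⁺ (inj₁ (x∈⁅x⁆ x)) ; (inj₂ refl) → x∈p∪q⁺ {p = ⁅ y ⁆} (inj₂ (x∈⁅x⁆ x)) })

vertex≼vertex : ∀ {n} (i j : Fin n) → inj₁ i ≼ᵇ inj₁ j ≡ does (i ≟ j)
vertex≼vertex i j = does-⇔ (⇔-trans ⁅x⁆⊆p⇔x∈p x∈⁅y⁆⇔x≡y) (⁅ i ⁆ ⊆? ⁅ j ⁆) (i ≟ j)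

vertex≼edge : ∀ {n} (i j : Fin n) → inj₁ i ≼ᵇ inj₂ j ≡ does (i ≟ j) ∨ does (i ≟ next j)
vertex≼edge i j = does-⇔ (⇔-trans ⁅x⁆⊆p⇔x∈p x∈⁅y⁆∪⁅z⁆⇔) (⁅ i ⁆ ⊆? verts (inj₂ j)) (i ≟ j ⊎-dec i ≟ next j)

edge⋠vertex : ∀ {k} (i j : Fin (2 + k)) → inj₂ i ≼ᵇ inj₁ j ≡ false
edge⋠vertex i j = dec-false (verts (inj₂ i) ⊆? ⁅ j ⁆) λ edge⊆⁅j⁆ →
  let i∈⁅j⁆ , next-i∈⁅j⁆ = to edge⊆p⇔ edge⊆⁅j⁆ in
  next-irreflexive i (trans (x∈⁅y⁆⇒x≡y j next-i∈⁅j⁆) (sym (x∈⁅y⁆⇒x≡y j i∈⁅j⁆)))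

edge≼edge : ∀ {k} (i j : Fin (3 + k)) → inj₂ i ≼ᵇ inj₂ j ≡ does (i ≟ j)
edge≼edge i j = does-⇔ (⇔-trans edge⊆p⇔ (mk⇔ endpoints∈edge⇒≡ ≡⇒endpoints∈edge))
                       (verts (inj₂ i) ⊆? verts (inj₂ j)) (i ≟ j)
  where
  endpoints∈edge⇒≡ : i ∈ verts (inj₂ j) × next i ∈ verts (inj₂ j) → i ≡ j
  endpoints∈edge⇒≡ (i∈ , next-i∈) with to x∈⁅y⁆∪⁅z⁆⇔ i∈ | to x∈⁅y⁆∪⁅z⁆⇔ next-i∈
  ... | inj₁ i≡j      | _                  = i≡j
  ... | inj₂ i≡next-j | inj₁ next-i≡j      =
    ⊥-elim (next²-irreflexive j (trans (cong next (sym i≡next-j)) next-i≡j))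
  ... | inj₂ i≡next-j | inj₂ next-i≡next-j =
    ⊥-elim (next-irreflexive i (trans next-i≡next-j (sym i≡next-j)))

  ≡⇒endpoints∈edge : i ≡ j → i ∈ verts (inj₂ j) × next i ∈ verts (inj₂ j)
  ≡⇒endpoints∈edge refl = from x∈⁅y⁆∪⁅z⁆⇔ (inj₁ refl) , from x∈⁅y⁆∪⁅z⁆⇔ (inj₂ refl)

anyFin-cong : ∀ {n} {f g : Fin n → Bool} → (∀ i → f i ≡ g i) → anyFin f ≡ anyFin g
anyFin-cong {zero}  _   = refl
anyFin-cong {suc n} f≗g = cong₂ _∨_ (f≗g zero) (anyFin-cong (f≗g ∘ suc))

anyFin-false : ∀ {n} → anyFin {n} (λ _ → false) ≡ false
anyFin-false {zero}  = refl
anyFin-false {suc n} = anyFin-false {n}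

anyFin-∨ : ∀ {n} (f g : Fin n → Bool) → anyFin (λ i → f i ∨ g i) ≡ anyFin f ∨ anyFin g
anyFin-∨ {zero}  f g = refl
anyFin-∨ {suc n} f g =
  trans (cong ((f zero ∨ g zero) ∨_) (anyFin-∨ (f ∘ suc) (g ∘ suc)))
        (∨-interchange (f zero) (g zero) (anyFin (f ∘ suc)) (anyFin (g ∘ suc)))

anyFin-select : ∀ {n} (f : Fin n → Bool) (j : Fin n) → anyFin (λ i → f i ∧ does (i ≟ j)) ≡ f j
anyFin-select {suc n} f zero = begin
  f zero ∧ true ∨ anyFin (λ i → f (suc i) ∧ false)
    ≡⟨ cong₂ _∨_ (∧-identityʳ (f zero)) (trans (anyFin-cong (λ i → ∧-zeroʳ (f (suc i)))) (anyFin-false {n})) ⟩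
  f zero ∨ false
    ≡⟨ ∨-identityʳ (f zero) ⟩
  f zero ∎
anyFin-select f (suc j) =
  trans (cong (_∨ anyFin (λ i → f (suc i) ∧ does (i ≟ j))) (∧-zeroʳ (f zero))) (anyFin-select (f ∘ suc) j)

rotate : ∀ {A : Set} {n} → Vec A n → Vec A n
rotate []       = []
rotate (x ∷ xs) = xs ∷ʳ x

lookup-∷ʳ-fromℕ : ∀ {A : Set} {n} (xs : Vec A n) x → lookup (xs ∷ʳ x) (fromℕ n) ≡ x
lookup-∷ʳ-fromℕ []       x = refl
lookup-∷ʳ-fromℕ (y ∷ xs) x = lookup-∷ʳ-fromℕ xs x

lookup-∷ʳ-inject₁ : ∀ {A : Set} {n} (xs : Vec A n) x i → lookup (xs ∷ʳ x) (inject₁ i) ≡ lookup xs i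
lookup-∷ʳ-inject₁ (y ∷ xs) x zero    = refl
lookup-∷ʳ-inject₁ (y ∷ xs) x (suc i) = lookup-∷ʳ-inject₁ xs x i

lookup-rotate : ∀ {A : Set} {n} (xs : Vec A n) i → lookup (rotate xs) i ≡ lookup xs (next i)
lookup-rotate (x ∷ xs) i with view i
... | ‵fromℕ     = trans (lookup-∷ʳ-fromℕ xs x) (cong (lookup (x ∷ xs)) (sym (next-fromℕ _)))
... | ‵inject₁ j = trans (lookup-∷ʳ-inject₁ xs x j) (cong (lookup (x ∷ xs)) (sym (next-inject₁ j)))

-- Edge j joins j and next j, so it meets A exactly when j ∈ A or j ∈ rotate A.
incidentEdges : ∀ {n} → Subset n → Subset n
incidentEdges A = A ∪ rotate A

lookup-incidentEdges : ∀ {n} (A : Subset n) j → lookup (incidentEdges A) j ≡ lookup A j ∨ lookup A (next j)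
lookup-incidentEdges A j =
  trans (lookup-zipWith _∨_ j A (rotate A)) (cong (lookup A j ∨_) (lookup-rotate A j))

unionOfStars≡ : ∀ {k} (A B : Subset (3 + k)) → unionOfStars (A , B) ≡ (A , incidentEdges A ∪ B)
unionOfStars≡ {k} A B = cong₂ _,_ (tabulate≡ vertices) (tabulate≡ edges)
  where
  tabulate≡ : ∀ {m} {f : Fin m → Bool} {v} → (∀ j → f j ≡ lookup v j) → tabulate f ≡ v
  tabulate≡ {v = v} f≗v = trans (tabulate-cong f≗v) (tabulate∘lookup v)

  vertices : ∀ j → anySimplex (λ x → x ∈ᵇ (A , B) ∧ x ≼ᵇ inj₁ j) ≡ lookup A j
  vertices j = begin
    anyFin (λ i → lookup A i ∧ inj₁ i ≼ᵇ inj₁ j) ∨ anyFin (λ i → lookup B i ∧ inj₂ i ≼ᵇ inj₁ j)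
      ≡⟨ cong₂ _∨_ (anyFin-cong λ i → cong (lookup A i ∧_) (vertex≼vertex i j))
                   (anyFin-cong λ i → trans (cong (lookup B i ∧_) (edge⋠vertex i j)) (∧-zeroʳ (lookup B i))) ⟩
    anyFin (λ i → lookup A i ∧ does (i ≟ j)) ∨ anyFin {3 + k} (λ _ → false)
      ≡⟨ cong₂ _∨_ (anyFin-select (lookup A) j) (anyFin-false {3 + k}) ⟩
    lookup A j ∨ false
      ≡⟨ ∨-identityʳ _ ⟩
    lookup A j ∎

  edges : ∀ j → anySimplex (λ x → x ∈ᵇ (A , B) ∧ x ≼ᵇ inj₂ j) ≡ lookup (incidentEdges A ∪ B) j
  edges j = begin
    anyFin (λ i → lookup A i ∧ inj₁ i ≼ᵇ inj₂ j) ∨ anyFin (λ i → lookup B i ∧ inj₂ i ≼ᵇ inj₂ j)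
      ≡⟨ cong₂ _∨_ (anyFin-cong λ i → trans (cong (lookup A i ∧_) (vertex≼edge i j))
                                            (∧-distribˡ-∨ (lookup A i) (does (i ≟ j)) (does (i ≟ next j))))
                   (anyFin-cong λ i → cong (lookup B i ∧_) (edge≼edge i j)) ⟩
    anyFin (λ i → lookup A i ∧ does (i ≟ j) ∨ lookup A i ∧ does (i ≟ next j))
      ∨ anyFin (λ i → lookup B i ∧ does (i ≟ j))
      ≡⟨ cong₂ _∨_ (trans (anyFin-∨ (λ i → lookup A i ∧ does (i ≟ j)) (λ i → lookup A i ∧ does (i ≟ next j)))
                          (cong₂ _∨_ (anyFin-select (lookup A) j) (anyFin-select (lookup A) (next j))))
                   (anyFin-select (lookup B) j) ⟩
    (lookup A j ∨ lookup A (next j)) ∨ lookup B j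
      ≡⟨ cong (_∨ lookup B j) (sym (lookup-incidentEdges A j)) ⟩
    lookup (incidentEdges A) j ∨ lookup B j
      ≡⟨ sym (lookup-zipWith _∨_ j (incidentEdges A) B) ⟩
    lookup (incidentEdges A ∪ B) j ∎

-- Counting open sets

concatMap-map≡cartesianProductWith : ∀ {A B C : Set} (f : A → B → C) xs ys →
  concatMap (λ x → map (f x) ys) xs ≡ cartesianProductWith f xs ys
concatMap-map≡cartesianProductWith f []       ys = refl
concatMap-map≡cartesianProductWith f (x ∷ xs) ys =
  cong (map (f x) ys ++_) (concatMap-map≡cartesianProductWith f xs ys)

allSubsets-suc : ∀ n →
  allSubsets (suc n) ≡ cartesianProductWith (λ s b → b ∷ s) (allSubsets n) (outside ∷ inside ∷ [])
allSubsets-suc n = concatMap-map≡cartesianProductWith (λ s b → b ∷ s) (allSubsets n) (outside ∷ inside ∷ [])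

allSubsets-complete : ∀ {n} (s : Subset n) → s ∈ˡ allSubsets n
allSubsets-complete []      = here refl
allSubsets-complete {suc n} (b ∷ s) = subst (b ∷ s ∈ˡ_) (sym (allSubsets-suc n))
  (∈-cartesianProductWith⁺ (λ s b → b ∷ s) (allSubsets-complete s) (sides b))
  where
  sides : ∀ b → b ∈ˡ outside ∷ inside ∷ []
  sides false = here refl
  sides true  = there (here refl)

allSubsets-unique : ∀ n → Unique (allSubsets n)
allSubsets-unique zero    = [] ∷ []
allSubsets-unique (suc n) = subst Unique (sym (allSubsets-suc n))
  (cartesianProductWith⁺ (λ s b → b ∷ s) (swap ∘ ∷-injective) (allSubsets-unique n)
                         (((λ ()) ∷ []) ∷ [] ∷ []))

allSubG≡cartesianProduct : ∀ n → allSubG n ≡ cartesianProduct (allSubsets n) (allSubsets n)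
allSubG≡cartesianProduct n = concatMap-map≡cartesianProductWith _,_ (allSubsets n) (allSubsets n)

allSubG-complete : ∀ {n} (x : SubG n) → x ∈ˡ allSubG n
allSubG-complete {n} (A , B) = subst ((A , B) ∈ˡ_) (sym (allSubG≡cartesianProduct n))
  (∈-cartesianProduct⁺ (allSubsets-complete A) (allSubsets-complete B))

allSubG-unique : ∀ n → Unique (allSubG n)
allSubG-unique n = subst Unique (sym (allSubG≡cartesianProduct n))
  (cartesianProduct⁺ (allSubsets-unique n) (allSubsets-unique n))

IsOpen : ∀ {n} → SubG n → Set
IsOpen (A , B) = incidentEdges A ⊆ B

isOpen? : ∀ {n} → Decidable (IsOpen {n})
isOpen? (A , B) = incidentEdges A ⊆? B

p⊆q⇒p∪q≡q : ∀ {n} {p q : Subset n} → p ⊆ q → p ∪ q ≡ q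
p⊆q⇒p∪q≡q {p = p} {q} p⊆q = ⊆-antisym (λ x∈p∪q → [ p⊆q , id ] (x∈p∪q⁻ p q x∈p∪q)) (q⊆p∪q p q)

∈-map-unionOfStars⇔IsOpen : ∀ {k} {x : SubG (3 + k)} → x ∈ˡ map unionOfStars (allSubG (3 + k)) ⇔ IsOpen x
∈-map-unionOfStars⇔IsOpen {k} {x} = mk⇔ to′ from′
  where
  to′ : x ∈ˡ map unionOfStars (allSubG (3 + k)) → IsOpen x
  to′ x∈ with ∈-map⁻ unionOfStars x∈
  ... | (A , B) , _ , x≡ = subst IsOpen (sym (trans x≡ (unionOfStars≡ A B))) (p⊆p∪q B)
  from′ : IsOpen x → x ∈ˡ map unionOfStars (allSubG (3 + k))
  from′ open-x = subst (_∈ˡ map unionOfStars (allSubG (3 + k)))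
    (trans (unionOfStars≡ (proj₁ x) (proj₂ x)) (cong (proj₁ x ,_) (p⊆q⇒p∪q≡q open-x)))
    (∈-map⁺ unionOfStars (allSubG-complete x))

length-deduplicate : ∀ {A : Set} (_≟_ : DecidableEquality A) {xs ys : List A} →
  Unique ys → (∀ {z} → z ∈ˡ xs ⇔ z ∈ˡ ys) → length (deduplicate _≟_ xs) ≡ length ys
length-deduplicate _≟_ {xs} ys! xs⇔ys = ↭-length (∼bag⇒↭ (unique∧set⇒bag
  (deduplicate-! _≟_ xs) ys! (⇔-trans (⇔-sym (deduplicate-∈⇔ _≟_)) xs⇔ys)))

length-openSets : ∀ k → length (openSets (3 + k)) ≡ length (filter isOpen? (allSubG (3 + k)))
length-openSets k = length-deduplicate _≟G_ (filter⁺ isOpen? (allSubG-unique (3 + k)))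
  (⇔-trans ∈-map-unionOfStars⇔IsOpen
           (mk⇔ (∈-filter⁺ isOpen? (allSubG-complete _)) (proj₂ ∘ ∈-filter⁻ isOpen? {xs = allSubG (3 + k)})))

length-filter-map : ∀ {A B : Set} {P : B → Set} (P? : Decidable P) (f : A → B) xs →
  length (filter P? (map f xs)) ≡ length (filter (P? ∘ f) xs)
length-filter-map P? f []       = refl
length-filter-map P? f (x ∷ xs) with does (P? (f x))
... | true  = cong suc (length-filter-map P? f xs)
... | false = length-filter-map P? f xs

length-filter-cartesianProduct : ∀ {A B : Set} {P : A × B → Set} (P? : Decidable P) xs ys →
  length (filter P? (cartesianProduct xs ys)) ≡ sum (map (λ x → length (filter (P? ∘ (x ,_)) ys)) xs)
length-filter-cartesianProduct P? []       ys = refl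
length-filter-cartesianProduct P? (x ∷ xs) ys = begin
  length (filter P? (map (x ,_) ys ++ cartesianProduct xs ys))
    ≡⟨ cong length (filter-++ P? (map (x ,_) ys) (cartesianProduct xs ys)) ⟩
  length (filter P? (map (x ,_) ys) ++ filter P? (cartesianProduct xs ys))
    ≡⟨ length-++ (filter P? (map (x ,_) ys)) ⟩
  length (filter P? (map (x ,_) ys)) + length (filter P? (cartesianProduct xs ys))
    ≡⟨ cong₂ _+_ (length-filter-map P? (x ,_) ys) (length-filter-cartesianProduct P? xs ys) ⟩
  length (filter (P? ∘ (x ,_)) ys) + sum (map (λ x → length (filter (P? ∘ (x ,_)) ys)) xs) ∎

sum-map-*ˡ : ∀ {A : Set} k (g : A → ℕ) xs → sum (map (λ x → k * g x) xs) ≡ k * sum (map g xs)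
sum-map-*ˡ k g []       = sym (ℕ.*-zeroʳ k)
sum-map-*ˡ k g (x ∷ xs) =
  trans (cong (k * g x +_) (sum-map-*ˡ k g xs)) (sym (ℕ.*-distribˡ-+ k (g x) _))

sum-map-allSubsets-suc : ∀ {n} (g : Subset (suc n) → ℕ) → sum (map g (allSubsets (suc n)))
  ≡ sum (map (g ∘ (outside ∷_)) (allSubsets n)) + sum (map (g ∘ (inside ∷_)) (allSubsets n))
sum-map-allSubsets-suc g = split (allSubsets _)
  where
  split : ∀ xs → sum (map g (concatMap (λ s → (outside ∷ s) ∷ (inside ∷ s) ∷ []) xs))
                 ≡ sum (map (g ∘ (outside ∷_)) xs) + sum (map (g ∘ (inside ∷_)) xs)
  split []       = refl
  split (s ∷ xs) = begin
    g (outside ∷ s) + (g (inside ∷ s) + sum (map g (concatMap _ xs)))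
      ≡⟨ cong (λ t → g (outside ∷ s) + (g (inside ∷ s) + t)) (split xs) ⟩
    g (outside ∷ s) + (g (inside ∷ s) + (sum (map (g ∘ (outside ∷_)) xs) + sum (map (g ∘ (inside ∷_)) xs)))
      ≡⟨ sym (ℕ.+-assoc (g (outside ∷ s)) (g (inside ∷ s)) _) ⟩
    g (outside ∷ s) + g (inside ∷ s) + (sum (map (g ∘ (outside ∷_)) xs) + sum (map (g ∘ (inside ∷_)) xs))
      ≡⟨ +-interchange (g (outside ∷ s)) (g (inside ∷ s)) _ _ ⟩
    g (outside ∷ s) + sum (map (g ∘ (outside ∷_)) xs) + (g (inside ∷ s) + sum (map (g ∘ (inside ∷_)) xs)) ∎

supersets-count : ∀ {n} (c : Subset n) → length (filter (c ⊆?_) (allSubsets n)) ≡ 2 ^ ∣ ∁ c ∣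
supersets-count []      = refl
supersets-count {suc n} (outside ∷ c) = trans (extend (allSubsets n)) (cong (2 *_) (supersets-count c))
  where
  extend : ∀ xs → length (filter ((outside ∷ c) ⊆?_) (concatMap (λ s → (outside ∷ s) ∷ (inside ∷ s) ∷ []) xs))
                  ≡ 2 * length (filter (c ⊆?_) xs)
  extend []       = refl
  -- Both outside ∷ b and inside ∷ b are decided by c ⊆? b.
  extend (b ∷ xs) with does (c ⊆? b) in c⊆?b
  ... | true  rewrite c⊆?b = trans (cong (2 +_) (extend xs)) (sym (ℕ.*-suc 2 _))
  ... | false rewrite c⊆?b = extend xs
supersets-count {suc n} (inside ∷ c) = trans (extend (allSubsets n)) (supersets-count c)
  where
  extend : ∀ xs → length (filter ((inside ∷ c) ⊆?_) (concatMap (λ s → (outside ∷ s) ∷ (inside ∷ s) ∷ []) xs))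
                  ≡ length (filter (c ⊆?_) xs)
  extend []       = refl
  extend (b ∷ xs) with does (c ⊆? b)
  ... | true  = cong suc (extend xs)
  ... | false = extend xs

cycleCount : ℕ → ℕ
cycleCount n = sum (map (λ A → 2 ^ ∣ ∁ (incidentEdges A) ∣) (allSubsets n))

length-filter-isOpen : ∀ n → length (filter isOpen? (allSubG n)) ≡ cycleCount n
length-filter-isOpen n = begin
  length (filter isOpen? (allSubG n))
    ≡⟨ cong (length ∘ filter isOpen?) (allSubG≡cartesianProduct n) ⟩
  length (filter isOpen? (cartesianProduct (allSubsets n) (allSubsets n)))
    ≡⟨ length-filter-cartesianProduct isOpen? (allSubsets n) (allSubsets n) ⟩
  sum (map (λ A → length (filter (incidentEdges A ⊆?_) (allSubsets n))) (allSubsets n))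
    ≡⟨ cong sum (map-cong (supersets-count ∘ incidentEdges) (allSubsets n)) ⟩
  cycleCount n ∎

-- Transfer matrix

pathIncidentEdges : ∀ {m} → Bool → Subset m → Bool → Subset (suc m)
pathIncidentEdges x ys z = (x ∷ ys) ∪ (ys ∷ʳ z)

-- Open sets (A , B) of the path with vertices x ∷ ys ∷ʳ z, counted over all A whose ends are x and z.
pathCount : ℕ → Bool → Bool → ℕ
pathCount m x z = sum (map (λ ys → 2 ^ ∣ ∁ (pathIncidentEdges x ys z) ∣) (allSubsets m))

pathCount-outside : ∀ m z → pathCount (suc m) outside z ≡ 2 * pathCount m outside z + pathCount m inside z
pathCount-outside m z = trans (sum-map-allSubsets-suc {m} (λ ys → 2 ^ ∣ ∁ (pathIncidentEdges outside ys z) ∣))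
  (cong (_+ pathCount m inside z)
        (sum-map-*ˡ 2 (λ ys → 2 ^ ∣ ∁ (pathIncidentEdges outside ys z) ∣) (allSubsets m)))

pathCount-inside : ∀ m z → pathCount (suc m) inside z ≡ pathCount m outside z + pathCount m inside z
pathCount-inside m z = sum-map-allSubsets-suc {m} (λ ys → 2 ^ ∣ ∁ (pathIncidentEdges inside ys z) ∣)

-- Cutting the cycle at vertex 0: incidentEdges (a ∷ as) is pathIncidentEdges a as a.
cycleCount≡pathCounts : ∀ m → cycleCount (suc m) ≡ pathCount m outside outside + pathCount m inside inside
cycleCount≡pathCounts m = sum-map-allSubsets-suc {m} (λ A → 2 ^ ∣ ∁ (incidentEdges A) ∣)

fib : ℕ → ℕ
fib 0             = 0
fib 1             = 1
fib (suc (suc k)) = fib (suc k) + fib k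

fib-4+ : ∀ k → fib (4 + k) ≡ 2 * fib (2 + k) + fib (1 + k)
fib-4+ k = lemma (fib (2 + k)) (fib (1 + k))
  where
  lemma : ∀ x y → (x + y) + x ≡ 2 * x + y
  lemma = solve-∀

fib-evolution : ∀ (a b : ℕ → ℕ) k →
  a 0 ≡ fib (2 + k) → b 0 ≡ fib (1 + k) →
  (∀ m → a (suc m) ≡ 2 * a m + b m) → (∀ m → b (suc m) ≡ a m + b m) →
  ∀ m → a m ≡ fib (2 + (k + 2 * m)) × b m ≡ fib (1 + (k + 2 * m))
fib-evolution a b k a₀ b₀ a-step b-step zero rewrite ℕ.+-identityʳ k = a₀ , b₀
fib-evolution a b k a₀ b₀ a-step b-step (suc m) with fib-evolution a b k a₀ b₀ a-step b-step m
... | aₘ , bₘ = a′ , b′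
  where
  index : ∀ k m → k + 2 * suc m ≡ 2 + (k + 2 * m)
  index = solve-∀
  a′ : a (suc m) ≡ fib (2 + (k + 2 * suc m))
  a′ = begin
    a (suc m)                                  ≡⟨ a-step m ⟩
    2 * a m + b m                              ≡⟨ cong₂ (λ x y → 2 * x + y) aₘ bₘ ⟩
    2 * fib (2 + (k + 2 * m)) + fib (1 + (k + 2 * m)) ≡⟨ sym (fib-4+ (k + 2 * m)) ⟩
    fib (4 + (k + 2 * m))                      ≡⟨ cong (λ j → fib (2 + j)) (sym (index k m)) ⟩
    fib (2 + (k + 2 * suc m))                  ∎
  b′ : b (suc m) ≡ fib (1 + (k + 2 * suc m))
  b′ = begin
    b (suc m)                                  ≡⟨ b-step m ⟩
    a m + b m                                  ≡⟨ cong₂ _+_ aₘ bₘ ⟩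
    fib (3 + (k + 2 * m))                      ≡⟨ cong (λ j → fib (1 + j)) (sym (index k m)) ⟩
    fib (1 + (k + 2 * suc m))                  ∎

lucas≡fib+fib : ∀ k → lucas (suc k) ≡ fib (2 + k) + fib k
lucas≡fib+fib zero          = refl
lucas≡fib+fib (suc zero)    = refl
lucas≡fib+fib (suc (suc k)) = begin
  lucas (2 + k) + lucas (1 + k)
    ≡⟨ cong₂ _+_ (lucas≡fib+fib (suc k)) (lucas≡fib+fib k) ⟩
  (fib (3 + k) + fib (1 + k)) + (fib (2 + k) + fib k)
    ≡⟨ +-interchange (fib (3 + k)) (fib (1 + k)) (fib (2 + k)) (fib k) ⟩
  fib (4 + k) + fib (2 + k) ∎

cycleCount≡lucas : ∀ m → cycleCount (suc m) ≡ lucas (2 * suc m)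
cycleCount≡lucas m = begin
  cycleCount (suc m)
    ≡⟨ cycleCount≡pathCounts m ⟩
  pathCount m outside outside + pathCount m inside inside
    ≡⟨ cong₂ _+_ (proj₁ (pathCount-fib outside 1 refl refl m)) (proj₂ (pathCount-fib inside 0 refl refl m)) ⟩
  fib (3 + 2 * m) + fib (1 + 2 * m)
    ≡⟨ sym (lucas≡fib+fib (suc (2 * m))) ⟩
  lucas (2 + 2 * m)
    ≡⟨ cong lucas (sym (ℕ.*-suc 2 m)) ⟩
  lucas (2 * suc m) ∎
  where
  pathCount-fib : ∀ z k → pathCount 0 outside z ≡ fib (2 + k) → pathCount 0 inside z ≡ fib (1 + k) →
    ∀ m → pathCount m outside z ≡ fib (2 + (k + 2 * m)) × pathCount m inside z ≡ fib (1 + (k + 2 * m))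
  pathCount-fib z k a₀ b₀ = fib-evolution (λ m → pathCount m outside z) (λ m → pathCount m inside z) k a₀ b₀
    (λ m → pathCount-outside m z) (λ m → pathCount-inside m z)

mainTheorem7 : (n : ℕ) → 4 ≤ n → length (openSets n) ≡ lucas (2 * n)
mainTheorem7 n@(suc (suc (suc (suc k)))) (s≤s (s≤s (s≤s (s≤s _)))) = begin
  length (openSets n)                  ≡⟨ length-openSets (suc k) ⟩
  length (filter isOpen? (allSubG n))  ≡⟨ length-filter-isOpen n ⟩
  cycleCount n                         ≡⟨ cycleCount≡lucas (3 + k) ⟩
  lucas (2 * n)                        ∎
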